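{- Let $G$ be a $(2,2)$-circuit. Then either $G=K_2^3$, or for every vertex $v$ of $G$ of degree $3$ there is an inverse 2a or inverse 2b move removing $v$ whose result is a $P(2,1)$-graph.
   Context: Graphs are finite multigraphs, loops allowed; a loop contributes $2$ to the degree. $K_2^3$ is the graph on two vertices with three parallel edges. A graph is $(k,\ell)$-sparse if every subgraph $(V',E')$ with at least one edge has $|E'|\le k|V'|-\ell$, and $(k,\ell)$-tight if also $|E|=k|V|-\ell$. A $(2,2)$-circuit is a graph $G$ with $|E|=2|V|-1$ such that $G-e$ is $(2,2)$-tight for every edge $e$. A $P(2,1)$-graph is a $(2,1)$-tight graph $G$ such that $G-e$ is $(2,2)$-tight for some edge $e$. Inverse 2a move: for a degree-3 vertex $v$ with three distinct neighbours, delete $v$ and its edges and add an edge between two of its neighbours. Inverse 2b move: for a degree-3 vertex $v$ joined by one edge to $x$ and two parallel edges to $y\neq x$, delete $v$ and its edges and add an edge $xy$. -}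

module Defs where

open import Data.Nat using (ℕ; zero; suc; _+_; _*_; _≤_)
open import Data.Bool using (Bool; true; false; if_then_else_; _∧_; not)
open import Data.Fin using (Fin; punchOut)
open import Data.Fin.Properties using (_≟_)
open import Data.Fin.Subset using (Subset; _∈_; ∣_∣)
open import Data.Product using (Σ; _×_; _,_; proj₁; proj₂; ∃)
open import Data.Sum using (_⊎_)
open import Data.Maybe using (Maybe; just; nothing)
open import Data.List using (List; []; _∷_; length; map; mapMaybe; removeAt)
open import Data.Nat.ListAction using (sum)
open import Data.List.Relation.Unary.All using (All)
open import Data.List.Relation.Binary.Pointwise using (Pointwise)
open import Data.List.Relation.Binary.Sublist.Propositional using (_⊆_)
open import Data.List.Relation.Binary.Permutation.Propositional using (_↭_)
open import Relation.Nullary using (Dec; yes; no; does; ¬_)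
open import Relation.Binary.PropositionalEquality using (_≡_; _≢_)
open import Function.Bundles using (_↔_; Inverse)

-- A finite multigraph with loops on vertex set Fin n: a list (multiset) of
-- edges, each an (unordered) pair of endpoints written as an ordered pair.
-- A loop is an edge (a , a).
Edge : ℕ → Set
Edge n = Fin n × Fin n

Edges : ℕ → Set
Edges n = List (Edge n)

-- (k,ℓ)-sparse: every subgraph (V',E') with at least one edge has
-- |E'| ≤ k|V'| - ℓ  (written without truncated subtraction).
-- E' ranges over sub-multisets of E (sublists), V' over vertex sets
-- containing all endpoints of E'.
Sparse : ℕ → ℕ → (n : ℕ) → Edges n → Set
Sparse k ℓ n E =
  (V' : Subset n) (E' : Edges n) → E' ⊆ E →
  All (λ e → (proj₁ e ∈ V') × (proj₂ e ∈ V')) E' →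
  1 ≤ length E' → length E' + ℓ ≤ k * ∣ V' ∣

Tight : ℕ → ℕ → (n : ℕ) → Edges n → Set
Tight k ℓ n E = Sparse k ℓ n E × (length E + ℓ ≡ k * n)

Circuit22 : (n : ℕ) → Edges n → Set
Circuit22 n E = (length E + 1 ≡ 2 * n) × ((i : Fin (length E)) → Tight 2 2 n (removeAt E i))

P21 : (n : ℕ) → Edges n → Set
P21 n E = Tight 2 1 n E × Σ (Fin (length E)) (λ i → Tight 2 2 n (removeAt E i))

-- Degree (a loop contributes 2).
ind : Bool → ℕ
ind true = 1
ind false = 0

deg : {n : ℕ} → Fin n → Edges n → ℕ
deg v E = sum (map (λ e → ind (does (proj₁ e ≟ v)) + ind (does (proj₂ e ≟ v))) E)

other : {n : ℕ} → Fin n → Edge n → Maybe (Fin n)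
other v (a , b) =
  if does (a ≟ v) ∧ not (does (b ≟ v)) then just b
  else if does (b ≟ v) ∧ not (does (a ≟ v)) then just a
  else nothing

nbrs : {n : ℕ} → Fin n → Edges n → List (Fin n)
nbrs v E = mapMaybe (other v) E

relabelDec : {n : ℕ} {v w : Fin (suc n)} → Dec (v ≡ w) → Maybe (Fin n)
relabelDec (yes _) = nothing
relabelDec (no p) = just (punchOut p)

relabel : {n : ℕ} → Fin (suc n) → Fin (suc n) → Maybe (Fin n)
relabel v w = relabelDec (v ≟ w)

relabelEdgeM : {n : ℕ} → Maybe (Fin n) → Maybe (Fin n) → Maybe (Edge n)
relabelEdgeM (just a) (just b) = just (a , b)
relabelEdgeM _ _ = nothing

deleteVertex : {n : ℕ} → Fin (suc n) → Edges (suc n) → Edges n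
deleteVertex v E = mapMaybe (λ e → relabelEdgeM (relabel v (proj₁ e)) (relabel v (proj₂ e))) E

-- Inverse 2a move at v with result a P(2,1)-graph: v has degree 3 and three
-- distinct neighbours x, y, z; delete v and add the edge xy (any pair of
-- neighbours can be taken as x, y since x, y, z are quantified).
Inv2aP21 : {n : ℕ} → Fin (suc n) → Edges (suc n) → Set
Inv2aP21 {n} v E =
  Σ (Fin (suc n)) λ x → Σ (Fin (suc n)) λ y → Σ (Fin (suc n)) λ z →
  Σ (v ≢ x) λ vx → Σ (v ≢ y) λ vy →
  (x ≢ y) × (y ≢ z) × (x ≢ z) × (deg v E ≡ 3) ×
  (nbrs v E ↭ (x ∷ y ∷ z ∷ [])) ×
  P21 n ((punchOut vx , punchOut vy) ∷ deleteVertex v E)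

Inv2bP21 : {n : ℕ} → Fin (suc n) → Edges (suc n) → Set
Inv2bP21 {n} v E =
  Σ (Fin (suc n)) λ x → Σ (Fin (suc n)) λ y →
  Σ (v ≢ x) λ vx → Σ (v ≢ y) λ vy →
  (x ≢ y) × (deg v E ≡ 3) ×
  (nbrs v E ↭ (x ∷ y ∷ y ∷ [])) ×
  P21 n ((punchOut vx , punchOut vy) ∷ deleteVertex v E)

MoveP21 : {n : ℕ} → Fin n → Edges n → Set
MoveP21 {zero} () E
MoveP21 {suc n} v E = Inv2aP21 v E ⊎ Inv2bP21 v E

-- Graph isomorphism: a vertex bijection σ such that the relabelled edge
-- list equals the target edge list as a multiset of unordered pairs.
SameEdge : {n : ℕ} → Edge n → Edge n → Set
SameEdge (a , b) (c , d) = ((a ≡ c) × (b ≡ d)) ⊎ ((a ≡ d) × (b ≡ c))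

Iso : (n : ℕ) → Edges n → (n' : ℕ) → Edges n' → Set
Iso n E n' E' = Σ (Fin n ↔ Fin n') λ σ → Σ (Edges n') λ F →
  Pointwise SameEdge (map (λ e → Inverse.to σ (proj₁ e) , Inverse.to σ (proj₂ e)) E) F × (F ↭ E')

K23 : Edges 2
K23 = (Fin.zero , Fin.suc Fin.zero) ∷ (Fin.zero , Fin.suc Fin.zero) ∷ (Fin.zero , Fin.suc Fin.zero) ∷ []

module Submission where

-- Small cases are settled by counting:
-- |V| = 0 is impossible, for |V| = 1 the single edge gives no vertex of
-- degree 3, and for |V| = 2 the three edges are non-loops, so G ≅ K₂³.
-- For |V| ≥ 3 and v of degree 3 the argument is:
--   * G has no loops: a loop survives in some G - e and is a one-vertex
--     subgraph with one edge, violating (2,2)-sparsity;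
--   * G - v is (2,2)-tight: it is a subgraph of G - e for an edge e at v,
--     and it has |E| - 3 = 2(|V| - 1) - 2 edges;
--   * adding any edge to a (2,2)-tight graph gives a P(2,1)-graph;
--   * the three neighbours of v are not all equal: the star of v lies in
--     G - e for an edge e not at v, and (2,2)-sparse graphs have at most
--     two parallel edges; so the neighbour list has shape x,y,z (move 2a)
--     or x,y,y (move 2b).

open import Defs
open import Data.Nat using (ℕ; zero; suc; _+_; _*_; _≤_; s≤s; z≤n)
open import Data.Nat.Properties
  using (+-suc; +-comm; +-identityʳ; +-assoc; *-suc; *-identityʳ; +-cancelʳ-≡; +-cancelʳ-≤;
         ≤-trans; ≤-refl; ≤-reflexive; n≤1+n; +-monoʳ-≤; +-mono-≤; *-monoʳ-≤;
         1+n≰n; 1+n≢0; suc-injective)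
open import Data.Bool using (Bool; true; false; if_then_else_)
open import Data.Fin using (Fin; punchIn)
open import Data.Fin.Properties using (_≟_; punchIn-punchOut)
open import Data.Fin.Subset using (Subset; _∈_; ∣_∣; ⁅_⁆; _∪_; outside)
open import Data.Fin.Subset.Properties using (x∈⁅x⁆; ∣⁅x⁆∣≡1; x∈p∪q⁺; p⊆q⇒∣p∣≤∣q∣; x∈⁅y⁆⇒x≡y)
open import Data.Vec using (insertAt) renaming (_∷_ to _∷ᵥ_; [] to []ᵥ)
open import Data.Vec.Properties using (insertAt-punchIn; []=⇒lookup; lookup⇒[]=)
open import Data.Product using (Σ; _×_; _,_; proj₁; proj₂)
open import Data.Sum using (_⊎_; inj₁; inj₂)
open import Data.List using (List; []; _∷_; length; map; filter; removeAt; lookup)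
open import Data.List.Properties using (length-map)
open import Data.List.Membership.Propositional using () renaming (_∈_ to _∈ₗ_)
open import Data.List.Relation.Unary.All using (All; []; _∷_)
import Data.List.Relation.Unary.All as All
open import Data.List.Relation.Unary.All.Properties
  using (all-filter; filter⁺) renaming (map⁺ to All-map⁺; map⁻ to All-map⁻)
open import Data.List.Relation.Unary.Any using (here; there)
open import Data.List.Relation.Binary.Sublist.Propositional
  using (_∷_; _∷ʳ_; ⊆-trans; from∈) renaming (_⊆_ to _⊑_)
open import Data.List.Relation.Binary.Sublist.Propositional.Properties
  using (filter-⊆) renaming (map⁺ to Sublist-map⁺)
open import Data.List.Relation.Binary.Pointwise using ([]; _∷_)
open import Data.List.Relation.Binary.Permutation.Propositional
  using (_↭_; prep; swap) renaming (refl to ↭-refl; trans to ↭-trans)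
open import Data.List.Relation.Binary.Permutation.Propositional.Properties using (All-resp-↭)
open import Function.Properties.Inverse using (↔-refl)
open import Relation.Nullary using (Dec; yes; no; ¬_; _⊎-dec_)
open import Relation.Unary using (Pred; Decidable)
open import Relation.Unary.Properties using (∁?)
open import Relation.Binary.Definitions using (DecidableEquality)
open import Relation.Binary.PropositionalEquality
open import Data.Empty using (⊥-elim)
open import Level using (0ℓ)

module _ {A : Set} {P : Pred A 0ℓ} (P? : Decidable P) where

  length-filter-split : (xs : List A) →
    length (filter P? xs) + length (filter (∁? P?) xs) ≡ length xs
  length-filter-split [] = refl
  length-filter-split (x ∷ xs) with P? x
  ... | yes _ = cong suc (length-filter-split xs)
  ... | no _ = trans (+-suc _ _) (cong suc (length-filter-split xs))

  filter-⊆-removeAt : (xs : List A) (i : Fin (length xs)) →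
    ¬ P (lookup xs i) → filter P? xs ⊑ removeAt xs i
  filter-⊆-removeAt (x ∷ xs) Fin.zero ¬px with P? x
  ... | yes px = ⊥-elim (¬px px)
  ... | no _ = filter-⊆ P? xs
  filter-⊆-removeAt (x ∷ xs) (Fin.suc i) ¬p with P? x
  ... | yes _ = refl ∷ filter-⊆-removeAt xs i ¬p
  ... | no _ = x ∷ʳ filter-⊆-removeAt xs i ¬p

  filter-witness : (xs : List A) → 1 ≤ length (filter P? xs) →
    Σ (Fin (length xs)) λ i → P (lookup xs i)
  filter-witness (x ∷ xs) h with P? x
  ... | yes px = Fin.zero , px
  ... | no _ with filter-witness xs h
  ...   | i , pi = Fin.suc i , pi

∈-removeAt : {A : Set} {x : A} (xs : List A) → 2 ≤ length xs → x ∈ₗ xs →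
  Σ (Fin (length xs)) λ j → x ∈ₗ removeAt xs j
∈-removeAt (_ ∷ []) (s≤s ()) _
∈-removeAt (_ ∷ _ ∷ _) _ (here p) = Fin.suc Fin.zero , here p
∈-removeAt (_ ∷ _ ∷ _) _ (there x∈) = Fin.zero , x∈

data Shape₃ {A : Set} (ns : List A) : Set where
  distinct : (x y z : A) → x ≢ y → y ≢ z → x ≢ z → ns ↭ x ∷ y ∷ z ∷ [] → Shape₃ ns
  single-double : (x y : A) → x ≢ y → ns ↭ x ∷ y ∷ y ∷ [] → Shape₃ ns
  triple : (y : A) → ns ≡ y ∷ y ∷ y ∷ [] → Shape₃ ns

shape₃ : {A : Set} → DecidableEquality A → (ns : List A) → length ns ≡ 3 → Shape₃ ns
shape₃ _≟ₐ_ (x ∷ y ∷ z ∷ []) _ with x ≟ₐ y | y ≟ₐ z | x ≟ₐ z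
... | yes refl | yes refl | _ = triple x refl
... | yes refl | no y≢z | _ = single-double z x (λ z≡x → y≢z (sym z≡x))
  (↭-trans (prep x (swap x z ↭-refl)) (swap x z ↭-refl))
... | no x≢y | yes refl | _ = single-double x y x≢y ↭-refl
... | no x≢y | no y≢z | yes refl = single-double y x y≢z (swap x y ↭-refl)
... | no x≢y | no y≢z | no x≢z = distinct x y z x≢y y≢z x≢z ↭-refl

∣p∪q∣≤∣p∣+∣q∣ : {m : ℕ} (p q : Subset m) → ∣ p ∪ q ∣ ≤ ∣ p ∣ + ∣ q ∣
∣p∪q∣≤∣p∣+∣q∣ []ᵥ []ᵥ = z≤n
∣p∪q∣≤∣p∣+∣q∣ (true ∷ᵥ p) (true ∷ᵥ q) =
  s≤s (≤-trans (≤-trans (∣p∪q∣≤∣p∣+∣q∣ p q) (n≤1+n _)) (≤-reflexive (sym (+-suc ∣ p ∣ ∣ q ∣))))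
∣p∪q∣≤∣p∣+∣q∣ (true ∷ᵥ p) (false ∷ᵥ q) = s≤s (∣p∪q∣≤∣p∣+∣q∣ p q)
∣p∪q∣≤∣p∣+∣q∣ (false ∷ᵥ p) (true ∷ᵥ q) =
  ≤-trans (s≤s (∣p∪q∣≤∣p∣+∣q∣ p q)) (≤-reflexive (sym (+-suc ∣ p ∣ ∣ q ∣)))
∣p∪q∣≤∣p∣+∣q∣ (false ∷ᵥ p) (false ∷ᵥ q) = ∣p∪q∣≤∣p∣+∣q∣ p q

∈⇒1≤∣p∣ : {m : ℕ} {x : Fin m} (p : Subset m) → x ∈ p → 1 ≤ ∣ p ∣
∈⇒1≤∣p∣ {x = x} p x∈p =
  subst (_≤ ∣ p ∣) (∣⁅x⁆∣≡1 x)
    (p⊆q⇒∣p∣≤∣q∣ λ y∈⁅x⁆ → subst (_∈ p) (sym (x∈⁅y⁆⇒x≡y _ y∈⁅x⁆)) x∈p)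

∣insertAt-outside∣ : {m : ℕ} (p : Subset m) (v : Fin (suc m)) → ∣ insertAt p v outside ∣ ≡ ∣ p ∣
∣insertAt-outside∣ p Fin.zero = refl
∣insertAt-outside∣ (true ∷ᵥ p) (Fin.suc v) = cong suc (∣insertAt-outside∣ p v)
∣insertAt-outside∣ (false ∷ᵥ p) (Fin.suc v) = ∣insertAt-outside∣ p v

punchIn-∈ : {m : ℕ} (v : Fin (suc m)) (p : Subset m) {x : Fin m} → x ∈ p →
  punchIn v x ∈ insertAt p v outside
punchIn-∈ v p {x} x∈p =
  lookup⇒[]= (punchIn v x) (insertAt p v outside)
    (trans (insertAt-punchIn p v outside x) ([]=⇒lookup x∈p))

NonLoop : {n : ℕ} → Edge n → Set
NonLoop e = proj₁ e ≢ proj₂ e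

Loopless : {n : ℕ} → Edges n → Set
Loopless = All NonLoop

Within : {n : ℕ} → Subset n → Edge n → Set
Within P e = (proj₁ e ∈ P) × (proj₂ e ∈ P)

Incident : {n : ℕ} → Fin n → Edge n → Set
Incident v e = proj₁ e ≡ v ⊎ proj₂ e ≡ v

incident? : {n : ℕ} (v : Fin n) → Decidable (Incident v)
incident? v e = (proj₁ e ≟ v) ⊎-dec (proj₂ e ≟ v)

-- The endpoint of an edge at v other than v (meaningful for edges at v).
opposite : {n : ℕ} → Fin n → Edge n → Fin n
opposite v (a , b) = if Dec.does (a ≟ v) then b else a

opposite-at-first : {n : ℕ} {v a b : Fin n} → a ≡ v → opposite v (a , b) ≡ b
opposite-at-first {v = v} {a} a≡v with a ≟ v
... | yes _ = refl
... | no a≢v = ⊥-elim (a≢v a≡v)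

opposite-at-second : {n : ℕ} {v a b : Fin n} → a ≢ v → opposite v (a , b) ≡ a
opposite-at-second {v = v} {a} a≢v with a ≟ v
... | yes a≡v = ⊥-elim (a≢v a≡v)
... | no _ = refl

module Star {n : ℕ} (v : Fin n) where

  star : Edges n → Edges n
  star = filter (incident? v)

  deg≡∣star∣ : (E : Edges n) → Loopless E → deg v E ≡ length (star E)
  deg≡∣star∣ [] [] = refl
  deg≡∣star∣ ((a , b) ∷ E) (a≢b ∷ ls) with a ≟ v | b ≟ v
  ... | yes refl | yes refl = ⊥-elim (a≢b refl)
  ... | yes _ | no _ = cong suc (deg≡∣star∣ E ls)
  ... | no _ | yes _ = cong suc (deg≡∣star∣ E ls)
  ... | no _ | no _ = deg≡∣star∣ E ls

  nbrs≡opposites : (E : Edges n) → Loopless E → nbrs v E ≡ map (opposite v) (star E)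
  nbrs≡opposites [] [] = refl
  nbrs≡opposites ((a , b) ∷ E) (a≢b ∷ ls) with a ≟ v | b ≟ v
  ... | yes refl | yes refl = ⊥-elim (a≢b refl)
  ... | yes a≡v | no _ = cong₂ _∷_ (sym (opposite-at-first a≡v)) (nbrs≡opposites E ls)
  ... | no a≢v | yes _ = cong₂ _∷_ (sym (opposite-at-second a≢v)) (nbrs≡opposites E ls)
  ... | no _ | no _ = nbrs≡opposites E ls

  opposite-≢ : (e : Edge n) → NonLoop e → Incident v e → v ≢ opposite v e
  opposite-≢ (a , b) a≢b inc with a ≟ v | inc
  ... | yes a≡v | _ = λ v≡b → a≢b (trans a≡v v≡b)
  ... | no a≢v | inj₁ a≡v = ⊥-elim (a≢v a≡v)
  ... | no _ | inj₂ b≡v = λ v≡a → a≢b (trans (sym v≡a) (sym b≡v))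

  opposite-within : (P : Subset n) {y : Fin n} → v ∈ P → y ∈ P →
    (e : Edge n) → Incident v e → opposite v e ≡ y → Within P e
  opposite-within P v∈P y∈P (a , b) inc opp with a ≟ v | inc
  ... | yes refl | _ = v∈P , subst (_∈ P) (sym opp) y∈P
  ... | no a≢v | inj₁ a≡v = ⊥-elim (a≢v a≡v)
  ... | no _ | inj₂ refl = subst (_∈ P) (sym opp) y∈P , v∈P

  nbrs-≢ : (E : Edges n) → Loopless E → All (v ≢_) (nbrs v E)
  nbrs-≢ E ls rewrite nbrs≡opposites E ls =
    All-map⁺ (All.zipWith (λ { {e} (nl , inc) → opposite-≢ e nl inc })
      (filter⁺ (incident? v) ls , all-filter (incident? v) E))

  star-within : (E : Edges n) → Loopless E → (y : Fin n) → All (_≡ y) (nbrs v E) →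
    All (Within (⁅ v ⁆ ∪ ⁅ y ⁆)) (star E)
  star-within E ls y all-y rewrite nbrs≡opposites E ls =
    All.zipWith (λ { {e} (inc , opp) → opposite-within (⁅ v ⁆ ∪ ⁅ y ⁆) v∈P y∈P e inc opp })
      (all-filter (incident? v) E , All-map⁻ all-y)
    where
    v∈P : v ∈ ⁅ v ⁆ ∪ ⁅ y ⁆
    v∈P = x∈p∪q⁺ {p = ⁅ v ⁆} {q = ⁅ y ⁆} (inj₁ (x∈⁅x⁆ v))
    y∈P : y ∈ ⁅ v ⁆ ∪ ⁅ y ⁆
    y∈P = x∈p∪q⁺ {p = ⁅ v ⁆} {q = ⁅ y ⁆} (inj₂ (x∈⁅x⁆ y))

module Deletion {m : ℕ} (v : Fin (suc m)) where
  open Star v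

  liftEdge : Edge m → Edge (suc m)
  liftEdge (a , b) = punchIn v a , punchIn v b

  lift-deleteVertex : (E : Edges (suc m)) →
    map liftEdge (deleteVertex v E) ≡ filter (∁? (incident? v)) E
  lift-deleteVertex [] = refl
  lift-deleteVertex ((a , b) ∷ E) with a ≟ v | b ≟ v | v ≟ a | v ≟ b
  ... | yes _ | _ | yes _ | _ = lift-deleteVertex E
  ... | yes a≡v | _ | no v≢a | _ = ⊥-elim (v≢a (sym a≡v))
  ... | no a≢v | _ | yes v≡a | _ = ⊥-elim (a≢v (sym v≡a))
  ... | no _ | yes _ | no _ | yes _ = lift-deleteVertex E
  ... | no _ | yes b≡v | no _ | no v≢b = ⊥-elim (v≢b (sym b≡v))
  ... | no _ | no b≢v | no _ | yes v≡b = ⊥-elim (b≢v (sym v≡b))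
  ... | no _ | no _ | no v≢a | no v≢b =
    cong₂ _∷_ (cong₂ _,_ (punchIn-punchOut v≢a) (punchIn-punchOut v≢b)) (lift-deleteVertex E)

  ∣lift-deleteVertex∣ : (E : Edges (suc m)) →
    length (deleteVertex v E) ≡ length (filter (∁? (incident? v)) E)
  ∣lift-deleteVertex∣ E = trans (sym (length-map liftEdge (deleteVertex v E))) (cong length (lift-deleteVertex E))

  ∣deleteVertex∣ : (E : Edges (suc m)) → Loopless E → length (deleteVertex v E) + deg v E ≡ length E
  ∣deleteVertex∣ E ls = begin
    length (deleteVertex v E) + deg v E
      ≡⟨ cong₂ _+_ (∣lift-deleteVertex∣ E) (deg≡∣star∣ E ls) ⟩
    length (filter (∁? (incident? v)) E) + length (star E)
      ≡⟨ +-comm _ (length (star E)) ⟩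
    length (star E) + length (filter (∁? (incident? v)) E)
      ≡⟨ length-filter-split (incident? v) E ⟩
    length E ∎
    where open ≡-Reasoning

  deleteVertex-⊆-removeAt : (E : Edges (suc m)) (i : Fin (length E)) → Incident v (lookup E i) →
    map liftEdge (deleteVertex v E) ⊑ removeAt E i
  deleteVertex-⊆-removeAt E i inc =
    subst (_⊑ removeAt E i) (sym (lift-deleteVertex E))
      (filter-⊆-removeAt (∁? (incident? v)) E i (λ ¬inc → ¬inc inc))

sparse-unlift : {k ℓ m : ℕ} (v : Fin (suc m)) (F : Edges (suc m)) (D : Edges m) →
  Sparse k ℓ (suc m) F → map (Deletion.liftEdge v) D ⊑ F → Sparse k ℓ m D
sparse-unlift {k} {ℓ} v F D sp D⊑F V' E' E'⊑D within nonempty =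
  subst₂ (λ a b → a + ℓ ≤ k * b) (length-map liftEdge E') (∣insertAt-outside∣ V' v)
    (sp (insertAt V' v outside) (map liftEdge E')
        (⊆-trans (Sublist-map⁺ liftEdge E'⊑D) D⊑F)
        (All-map⁺ (All.map (λ { {a , b} (a∈ , b∈) → punchIn-∈ v V' a∈ , punchIn-∈ v V' b∈ })
          within))
        (subst (1 ≤_) (sym (length-map liftEdge E')) nonempty))
  where open Deletion v using (liftEdge)

sparse⇒no-loop : {k ℓ n : ℕ} → k ≤ ℓ → (F : Edges n) → Sparse k ℓ n F → (a : Fin n) → ¬ (a , a) ∈ₗ F
sparse⇒no-loop {k} {ℓ} k≤ℓ F sp a loop∈F = 1+n≰n (≤-trans 1+ℓ≤k k≤ℓ)
  where
  1+ℓ≤k : suc ℓ ≤ k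
  1+ℓ≤k = subst (suc ℓ ≤_) (trans (cong (k *_) (∣⁅x⁆∣≡1 a)) (*-identityʳ k))
    (sp ⁅ a ⁆ ((a , a) ∷ []) (from∈ loop∈F) ((x∈⁅x⁆ a , x∈⁅x⁆ a) ∷ []) (s≤s z≤n))

sparse22-parallel : {n : ℕ} (F E' : Edges n) → Sparse 2 2 n F → (v y : Fin n) →
  E' ⊑ F → All (Within (⁅ v ⁆ ∪ ⁅ y ⁆)) E' → length E' ≤ 2
sparse22-parallel F [] sp v y _ _ = z≤n
sparse22-parallel F E'@(_ ∷ _) sp v y E'⊑F within =
  +-cancelʳ-≤ 2 (length E') 2
    (≤-trans (sp (⁅ v ⁆ ∪ ⁅ y ⁆) E' E'⊑F within (s≤s z≤n)) (*-monoʳ-≤ 2 ∣⁅v⁆∪⁅y⁆∣≤2))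
  where
  ∣⁅v⁆∪⁅y⁆∣≤2 : ∣ ⁅ v ⁆ ∪ ⁅ y ⁆ ∣ ≤ 2
  ∣⁅v⁆∪⁅y⁆∣≤2 = ≤-trans (∣p∪q∣≤∣p∣+∣q∣ ⁅ v ⁆ ⁅ y ⁆) (≤-reflexive (cong₂ _+_ (∣⁅x⁆∣≡1 v) (∣⁅x⁆∣≡1 y)))

sparse-extend : {k ℓ n : ℕ} → suc ℓ ≤ k → (a : Edge n) (D : Edges n) →
  Sparse k (suc ℓ) n D → Sparse k ℓ n (a ∷ D)
sparse-extend {ℓ = ℓ} 1+ℓ≤k a D sp V' E' (_ ∷ʳ E'⊑D) within nonempty =
  ≤-trans (+-monoʳ-≤ (length E') (n≤1+n ℓ)) (sp V' E' E'⊑D within nonempty)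
sparse-extend {k} 1+ℓ≤k a D sp V' (_ ∷ []) (refl ∷ _) ((a₁∈ , _) ∷ []) _ =
  ≤-trans 1+ℓ≤k (subst (_≤ k * ∣ V' ∣) (*-identityʳ k) (*-monoʳ-≤ k (∈⇒1≤∣p∣ V' a₁∈)))
sparse-extend {ℓ = ℓ} 1+ℓ≤k a D sp V' (_ ∷ E'@(_ ∷ _)) (refl ∷ E'⊑D) (_ ∷ within) _ =
  ≤-trans (≤-reflexive (sym (+-suc (length E') ℓ))) (sp V' E' E'⊑D within (s≤s z≤n))

tight22-extend : {n : ℕ} (a : Edge n) (D : Edges n) → Tight 2 2 n D → P21 n (a ∷ D)
tight22-extend a D tight@(sp , count) =
  (sparse-extend ≤-refl a D sp , trans (sym (+-suc (length D) 1)) count) , Fin.zero , tight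

-- A (2,2)-tight graph on at least two vertices has an edge (2 ≠ 2(k+2)).
tight22-has-edge : {k : ℕ} {D : Edges (suc (suc k))} → Tight 2 2 (suc (suc k)) D → 1 ≤ length D
tight22-has-edge {D = _ ∷ _} _ = s≤s z≤n
tight22-has-edge {k} {D = []} (_ , count) =
  ⊥-elim (1+n≢0 (trans (sym (+-suc k _)) (sym (suc-injective (suc-injective count)))))

circuit-size : {m : ℕ} (E : Edges (suc m)) → Circuit22 (suc m) E → length E ≡ suc (2 * m)
circuit-size {m} E (count , _) = suc-injective (trans (+-comm 1 (length E)) (trans count (*-suc 2 m)))

circuit-loopless : {n : ℕ} (E : Edges n) → Circuit22 n E → 2 ≤ length E → Loopless E
circuit-loopless E (_ , minus-tight) 2≤∣E∣ =
  All.tabulate λ { {a , b} ab∈E a≡b → no-loop a (subst (λ c → (a , c) ∈ₗ E) (sym a≡b) ab∈E) }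
  where
  no-loop : ∀ a → ¬ (a , a) ∈ₗ E
  no-loop a loop∈E with ∈-removeAt E 2≤∣E∣ loop∈E
  ... | j , loop∈E-j = sparse⇒no-loop ≤-refl (removeAt E j) (proj₁ (minus-tight j)) a loop∈E-j

module _ {m : ℕ} (E : Edges (suc m)) (circuit : Circuit22 (suc m) E) (loopless : Loopless E)
         (v : Fin (suc m)) (deg3 : deg v E ≡ 3) where
  open Star v
  open Deletion v

  circuit-deleteVertex : Tight 2 2 m (deleteVertex v E)
  circuit-deleteVertex = sparse , +-cancelʳ-≡ 2 _ _ count
    where
    incident-edge : Σ (Fin (length E)) λ i → Incident v (lookup E i)
    incident-edge = filter-witness (incident? v) E
      (subst (1 ≤_) (trans (sym deg3) (deg≡∣star∣ E loopless)) (s≤s z≤n))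
    i : Fin (length E)
    i = proj₁ incident-edge
    sparse : Sparse 2 2 m (deleteVertex v E)
    sparse = sparse-unlift {2} {2} v (removeAt E i) (deleteVertex v E) (proj₁ (proj₂ circuit i))
      (deleteVertex-⊆-removeAt E i (proj₂ incident-edge))
    count : length (deleteVertex v E) + 2 + 2 ≡ 2 * m + 2
    count = begin
      length (deleteVertex v E) + 2 + 2 ≡⟨ trans (+-assoc _ 2 2) (sym (+-assoc _ 3 1)) ⟩
      length (deleteVertex v E) + 3 + 1 ≡⟨ cong (λ d → length (deleteVertex v E) + d + 1) (sym deg3) ⟩
      length (deleteVertex v E) + deg v E + 1 ≡⟨ cong (_+ 1) (∣deleteVertex∣ E loopless) ⟩
      length E + 1 ≡⟨ proj₁ circuit ⟩
      2 * suc m ≡⟨ trans (*-suc 2 m) (+-comm 2 (2 * m)) ⟩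
      2 * m + 2 ∎
      where open ≡-Reasoning

  not-triple : 1 ≤ length (deleteVertex v E) → (y : Fin (suc m)) → nbrs v E ≢ y ∷ y ∷ y ∷ []
  not-triple 1≤∣D∣ y nbrs≡yyy = 1+n≰n {2} (subst (_≤ 2) ∣star∣≡3
    (sparse22-parallel (removeAt E j) (star E) (proj₁ (proj₂ circuit j)) v y
      (filter-⊆-removeAt (incident? v) E j (proj₂ missing-edge))
      (star-within E loopless y (subst (All (_≡ y)) (sym nbrs≡yyy) (refl ∷ refl ∷ refl ∷ [])))))
    where
    ∣star∣≡3 : length (star E) ≡ 3
    ∣star∣≡3 = trans (sym (deg≡∣star∣ E loopless)) deg3
    missing-edge : Σ (Fin (length E)) λ j → ¬ Incident v (lookup E j)
    missing-edge = filter-witness (∁? (incident? v)) E (subst (1 ≤_) (∣lift-deleteVertex∣ E) 1≤∣D∣)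
    j : Fin (length E)
    j = proj₁ missing-edge

  ∣nbrs∣≡3 : length (nbrs v E) ≡ 3
  ∣nbrs∣≡3 = begin
    length (nbrs v E) ≡⟨ cong length (nbrs≡opposites E loopless) ⟩
    length (map (opposite v) (star E)) ≡⟨ length-map (opposite v) (star E) ⟩
    length (star E) ≡⟨ sym (deg≡∣star∣ E loopless) ⟩
    deg v E ≡⟨ deg3 ⟩
    3 ∎
    where open ≡-Reasoning

  -- The inverse move at v, chosen by the shape of its neighbour list; the
  -- resulting graph is G - v plus one edge, hence a P(2,1)-graph.
  degree3-move : 1 ≤ length (deleteVertex v E) → MoveP21 v E
  degree3-move 1≤∣D∣ with shape₃ _≟_ (nbrs v E) ∣nbrs∣≡3
  ... | distinct x y z x≢y y≢z x≢z perm with All-resp-↭ perm (nbrs-≢ E loopless)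
  ...   | v≢x ∷ v≢y ∷ _ = inj₁ (x , y , z , v≢x , v≢y , x≢y , y≢z , x≢z , deg3 , perm ,
          tight22-extend _ _ circuit-deleteVertex)
  degree3-move _ | single-double x y x≢y perm with All-resp-↭ perm (nbrs-≢ E loopless)
  ...   | v≢x ∷ v≢y ∷ _ = inj₂ (x , y , v≢x , v≢y , x≢y , deg3 , perm ,
          tight22-extend _ _ circuit-deleteVertex)
  degree3-move 1≤∣D∣ | triple y nbrs≡yyy = ⊥-elim (not-triple 1≤∣D∣ y nbrs≡yyy)

single-edge-deg≢3 : {n : ℕ} (E : Edges n) → length E ≡ 1 → (v : Fin n) → deg v E ≢ 3
single-edge-deg≢3 ((a , b) ∷ []) _ v deg3 =
  1+n≰n (subst (_≤ 2) (trans (sym (+-identityʳ _)) deg3)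
    (+-mono-≤ (ind≤1 (Dec.does (a ≟ v))) (ind≤1 (Dec.does (b ≟ v)))))
  where
  ind≤1 : (b : Bool) → ind b ≤ 1
  ind≤1 true = s≤s z≤n
  ind≤1 false = z≤n

two-vertex-iso : (E : Edges 2) → length E ≡ 3 → Loopless E → Iso 2 E 2 K23
two-vertex-iso (e₁ ∷ e₂ ∷ e₃ ∷ []) _ (nl₁ ∷ nl₂ ∷ nl₃ ∷ []) =
  ↔-refl , K23 , (same e₁ nl₁ ∷ same e₂ nl₂ ∷ same e₃ nl₃ ∷ []) , ↭-refl
  where
  same : (e : Edge 2) → NonLoop e → SameEdge e (Fin.zero , Fin.suc Fin.zero)
  same (Fin.zero , Fin.zero) nl = ⊥-elim (nl refl)
  same (Fin.zero , Fin.suc Fin.zero) _ = inj₁ (refl , refl)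
  same (Fin.suc Fin.zero , Fin.zero) _ = inj₂ (refl , refl)
  same (Fin.suc Fin.zero , Fin.suc Fin.zero) nl = ⊥-elim (nl refl)

lemma5p9 : (n : ℕ) (E : Edges n) → Circuit22 n E →
    Iso n E 2 K23 ⊎ ((v : Fin n) → deg v E ≡ 3 → MoveP21 v E)
lemma5p9 zero E (count , _) = ⊥-elim (1+n≢0 (trans (+-comm 1 (length E)) count))
lemma5p9 (suc zero) E circuit = inj₂ λ v deg3 → ⊥-elim (single-edge-deg≢3 E (circuit-size E circuit) v deg3)
lemma5p9 (suc (suc zero)) E circuit =
  inj₁ (two-vertex-iso E ∣E∣≡3 (circuit-loopless E circuit (subst (2 ≤_) (sym ∣E∣≡3) (s≤s (s≤s z≤n)))))
  where
  ∣E∣≡3 : length E ≡ 3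
  ∣E∣≡3 = circuit-size E circuit
lemma5p9 (suc (suc (suc k))) E circuit = inj₂ λ v deg3 →
  degree3-move E circuit loopless v deg3 (tight22-has-edge (circuit-deleteVertex E circuit loopless v deg3))
  where
  loopless : Loopless E
  loopless = circuit-loopless E circuit (subst (2 ≤_) (sym (circuit-size E circuit)) (s≤s (s≤s z≤n)))
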